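{- Let $n\geq 3$ and $T=\{x\in GF(4)^n: x_1+\cdots+x_n=0\}$. Then $\mathrm{mult}(T)$ is ideal.
   Context: A clutter $\mathcal{C}$ over a finite ground set $V$ is a family of subsets of $V$, no member containing another; it is ideal if every extreme point of $\{x\in\mathbb{R}^V: x\geq\mathbf{0},\ \sum_{v\in C}x_v\geq 1\ \forall C\in\mathcal{C}\}$ is integral. For a vector space $T\subseteq GF(q)^n$, take $n$ disjoint copies $V_1,\dots,V_n$ of $GF(q)$; $\mathrm{mult}(T)$ is the clutter over $V_1\cup\cdots\cup V_n$ with members $\{x_1,\dots,x_n\}$ ($x_i$ in copy $V_i$) for $(x_1,\dots,x_n)\in T$.
   Formalization: The polyhedron and its extreme points are taken in ℚ^V rather than ℝ^V, with extremality tested only against rational convex combinations of rational points. -}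

module Defs where

open import Data.Nat using (ℕ; zero; suc)
open import Data.Bool using (Bool; true; false; if_then_else_)
open import Data.Fin using (Fin)
open import Data.List using (List; []; _∷_; map; cartesianProduct; foldr; allFin)
open import Data.Product using (_×_; _,_; Σ; ∃)
open import Data.Integer using (ℤ)
open import Data.Rational using (ℚ; _+_; _*_; _-_; _≤_; _<_; 0ℚ; 1ℚ; _/_)
open import Relation.Binary.PropositionalEquality using (_≡_)

-- GF(4) = {0, 1, ω, ω²} with ω² = ω + 1 (characteristic 2).

data GF4 : Set where
  o i ω ω² : GF4

_⊕_ : GF4 → GF4 → GF4
o  ⊕ y  = y
x  ⊕ o  = x
i  ⊕ i  = o
i  ⊕ ω  = ω²
i  ⊕ ω² = ω
ω  ⊕ i  = ω²
ω  ⊕ ω  = o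
ω  ⊕ ω² = i
ω² ⊕ i  = ω
ω² ⊕ ω  = i
ω² ⊕ ω² = o

_⊗_ : GF4 → GF4 → GF4
o  ⊗ y  = o
i  ⊗ y  = y
x  ⊗ o  = o
x  ⊗ i  = x
ω  ⊗ ω  = ω²
ω  ⊗ ω² = i
ω² ⊗ ω  = i
ω² ⊗ ω² = ω

_≟GF4_ : GF4 → GF4 → Bool
o  ≟GF4 o  = true
i  ≟GF4 i  = true
ω  ≟GF4 ω  = true
ω² ≟GF4 ω² = true
_  ≟GF4 _  = false

allGF4 : List GF4
allGF4 = o ∷ i ∷ ω ∷ ω² ∷ []

sumGF4 : (n : ℕ) → (Fin n → GF4) → GF4
sumGF4 zero    x = o
sumGF4 (suc n) x = x Fin.zero ⊕ sumGF4 n (λ k → x (Fin.suc k))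
  where import Data.Fin as Fin

InT : (n : ℕ) → (Fin n → GF4) → Set
InT n x = sumGF4 n x ≡ o

-- Clutters over a finite ground set V, given by an enumeration of V.
-- A member (subset of V) is represented by its indicator function V → Bool;
-- the family is a predicate on such indicators.

record FiniteClutter : Set₁ where
  field
    V      : Set
    elems  : List V                 -- enumeration of V (each element once)
    Member : (V → Bool) → Set

sumℚ : List ℚ → ℚ
sumℚ = foldr _+_ 0ℚ

module _ (𝒞 : FiniteClutter) where
  open FiniteClutter 𝒞

  sumOver : (V → Bool) → (V → ℚ) → ℚ
  sumOver C x = sumℚ (map (λ v → if C v then x v else 0ℚ) elems)

  InPolyhedron : (V → ℚ) → Set
  InPolyhedron x = ((v : V) → 0ℚ ≤ x v)
                 × ((C : V → Bool) → Member C → 1ℚ ≤ sumOver C x)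

  IsExtremePoint : (V → ℚ) → Set
  IsExtremePoint x = InPolyhedron x
    × ((y z : V → ℚ) (λ' : ℚ) → InPolyhedron y → InPolyhedron z
        → 0ℚ < λ' → λ' < 1ℚ
        → ((v : V) → x v ≡ λ' * y v + (1ℚ - λ') * z v)
        → (v : V) → y v ≡ z v)

  IsIntegral : (V → ℚ) → Set
  IsIntegral x = (v : V) → ∃ λ (k : ℤ) → x v ≡ k / 1

  Ideal : Set
  Ideal = (x : V → ℚ) → IsExtremePoint x → IsIntegral x

-- mult(T): ground set V₁ ∪ ⋯ ∪ Vₙ = Fin n × GF(4) (copy i of GF(4) is
-- {i} × GF(4)); members {x₁,…,xₙ} = {(i , xᵢ)} for x ∈ T.

multIndicator : (n : ℕ) → (Fin n → GF4) → (Fin n × GF4) → Bool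
multIndicator n x (k , a) = x k ≟GF4 a

multT : (n : ℕ) → FiniteClutter
multT n = record
  { V      = Fin n × GF4
  ; elems  = cartesianProduct (allFin n) allGF4
  ; Member = λ C → Σ (Fin n → GF4) λ x → InT n x × ((v : Fin n × GF4) → C v ≡ multIndicator n x v)
  }

module Submission where

-- Let w be an extreme point of the polyhedron of mult(T). If some copy V_j carries weight at least
-- m > 0 at each of its points, then, since every member meets V_j exactly once, w can be moved away
-- from the indicator of V_j inside the polyhedron unless w is that indicator.
-- Otherwise every copy k has a point z_k of weight 0, and z ∉ T, so h = z_1 + ⋯ + z_n ≠ 0. Write
-- GF(4) = {0, h, x, y} with x + y = h and measure points of copy k relative to z_k; members become the
-- s with s_1 + ⋯ + s_n = h. As {0, x} and {0, y} are subgroups avoiding h, the 0/1 vectors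
-- A = [s_k ∈ {h, x}], B = [s_k ∈ {h, y}] and, for a copy k₀, E = [s_k₀ = h] + [s_k ≠ 0, k ≠ k₀] lie
-- in the polyhedron. Let α and β be the least weights of w at the points x and y, the first attained
-- in copy k₀. The members with two nonzero coordinates show that w dominates the convex combination
-- of A, B, E with weights (1, 0, 0), (α, 1 - α, 0) or (α, β, 1 - α - β); so w equals it, and being
-- extreme, w is one of the three pairwise distinct points A, B, E.

open import Algebra.Bundles using (CommutativeMonoid)
import Algebra.Properties.CommutativeSemigroup as CommSemigroupProperties
open import Data.Bool as Bool using (Bool; true; false; not; if_then_else_)
open import Data.Empty using (⊥-elim)
open import Data.Fin as Fin using (Fin; punchIn; punchOut)
open import Data.Fin.Properties using (punchInᵢ≢i; punchIn-punchOut; punchIn-injective; any?; all?; ¬∀⟶∃¬)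
import Data.Integer as ℤ
open import Data.List using (List; []; _∷_; map; _++_; tabulate; allFin; cartesianProduct)
open import Data.List.Membership.Propositional using (_∈_)
open import Data.List.Membership.Propositional.Properties using (∈-allFin)
open import Data.List.Properties using (map-++; map-cong)
open import Data.List.Relation.Unary.All using (lookup)
open import Data.List.Relation.Unary.Any using (here; there)
open import Data.Nat as ℕ using (ℕ; suc)
open import Data.Product using (∃; _×_; _,_; proj₁; proj₂)
open import Data.Rational using (ℚ; 0ℚ; 1ℚ; ½; _+_; _*_; _-_; -_; _≤_; _<_; _⊓_; positive; nonNegative)
open import Data.Rational.Properties
open import Data.Sum using (_⊎_; inj₁; inj₂)
open import Data.Vec.Functional using (updateAt)
open import Data.Vec.Functional.Properties using (updateAt-updates; updateAt-minimal)
open import Defs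
open import Level using (0ℓ)
open import Relation.Binary.Bundles using (DecTotalOrder)
open import Relation.Binary.PropositionalEquality
  using (_≡_; _≢_; _≗_; refl; sym; trans; cong; cong₂; subst; isEquivalence; module ≡-Reasoning)
open import Relation.Nullary using (¬_; Dec; yes; no; does)
open import Relation.Nullary.Decidable using (dec⇒maybe; dec-true; dec-false)
open import Tactic.RingSolver using (solve)
open import Tactic.RingSolver.Core.AlmostCommutativeRing using (AlmostCommutativeRing; fromCommutativeRing)
open import Data.List.Extrema (DecTotalOrder.totalOrder ≤-decTotalOrder) using (argmin; f[argmin]≤f[xs])

-- Without the zero test the solver keeps monomials whose coefficients cancel, such as (½ - ½) x.
ℚ-ring : AlmostCommutativeRing 0ℓ 0ℓ
ℚ-ring = fromCommutativeRing +-*-commutativeRing (λ q → dec⇒maybe (0ℚ ≟ q))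

open CommSemigroupProperties (CommutativeMonoid.commutativeSemigroup +-0-commutativeMonoid)
  using () renaming (interchange to +-interchange)

𝟙 : Bool → ℚ
𝟙 true  = 1ℚ
𝟙 false = 0ℚ

0≤1 : 0ℚ ≤ 1ℚ
0≤1 = <⇒≤ (positive⁻¹ 1ℚ)

0≤𝟙 : ∀ b → 0ℚ ≤ 𝟙 b
0≤𝟙 true  = 0≤1
0≤𝟙 false = ≤-refl

p≤p+q : ∀ {p q} → 0ℚ ≤ q → p ≤ p + q
p≤p+q {p} {q} 0≤q = subst (_≤ p + q) (+-identityʳ p) (+-monoʳ-≤ p 0≤q)

0≤q-p : ∀ {p q} → p ≤ q → 0ℚ ≤ q - p
0≤q-p {p} {q} p≤q = subst (_≤ q - p) (+-inverseʳ p) (+-monoˡ-≤ (- p) p≤q)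

*-nonNeg : ∀ {p q} → 0ℚ ≤ p → 0ℚ ≤ q → 0ℚ ≤ p * q
*-nonNeg {p} {q} 0≤p 0≤q = subst (_≤ p * q) (*-zeroʳ p) (*-monoˡ-≤-nonNeg p {{nonNegative 0≤p}} 0≤q)

*-pos : ∀ {p q} → 0ℚ < p → 0ℚ < q → 0ℚ < p * q
*-pos {p} {q} 0<p 0<q = subst (_< p * q) (*-zeroʳ p) (*-monoʳ-<-pos p {{positive 0<p}} 0<q)

*-monoˡ-≤-0≤ : ∀ {r p q} → 0ℚ ≤ r → p ≤ q → r * p ≤ r * q
*-monoˡ-≤-0≤ {r} 0≤r = *-monoˡ-≤-nonNeg r {{nonNegative 0≤r}}

*-cancelˡ-pos : ∀ {r p q} → 0ℚ < r → r * p ≡ r * q → p ≡ q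
*-cancelˡ-pos {r} 0<r e = ≤-antisym (*-cancelˡ-≤-pos r {{positive 0<r}} (≤-reflexive e))
                                    (*-cancelˡ-≤-pos r {{positive 0<r}} (≤-reflexive (sym e)))

≡-by-difference : ∀ {p q r s} → r ≡ s → p ≡ q + (r - s) → p ≡ q
≡-by-difference {q = q} {s = s} refl p≡q+0 = trans p≡q+0 (trans (cong (q +_) (+-inverseʳ s)) (+-identityʳ q))

nonNeg∧≯0⇒≡0 : ∀ {p} → 0ℚ ≤ p → ¬ 0ℚ < p → p ≡ 0ℚ
nonNeg∧≯0⇒≡0 0≤p ¬0<p = ≤-antisym (≮⇒≥ ¬0<p) 0≤p

p≤q+r⇒p-q≤r : ∀ {p q r} → p ≤ q + r → p - q ≤ r
p≤q+r⇒p-q≤r {p} {q} {r} p≤q+r = ≤-trans (+-monoˡ-≤ (- q) p≤q+r) (≤-reflexive (cancel q r))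
  where
  cancel : ∀ x y → x + y - x ≡ y
  cancel x y = solve (x ∷ y ∷ []) ℚ-ring

p≤q+r⇒p-r≤q : ∀ {p q r} → p ≤ q + r → p - r ≤ q
p≤q+r⇒p-r≤q {q = q} {r} p≤q+r = p≤q+r⇒p-q≤r (subst (_ ≤_) (+-comm q r) p≤q+r)

<⇒≱ : ∀ {p q} → p < q → ¬ q ≤ p
<⇒≱ p<q q≤p = <-irrefl refl (<-≤-trans p<q q≤p)

nonNeg∧≢0⇒pos : ∀ {p} → 0ℚ ≤ p → p ≢ 0ℚ → 0ℚ < p
nonNeg∧≢0⇒pos {p} 0≤p p≢0 with 0ℚ <? p
... | yes 0<p = 0<p
... | no 0≮p  = ⊥-elim (p≢0 (nonNeg∧≯0⇒≡0 0≤p 0≮p))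

½<1 : ½ < 1ℚ
½<1 = subst (_< 1ℚ) (+-identityʳ ½) (+-monoʳ-< ½ (positive⁻¹ ½))

-- Polyhedra of clutters and their extreme points

module _ {A : Set} where

  sumℚ-map-mono : ∀ {f g : A → ℚ} → (∀ v → f v ≤ g v) → ∀ vs → sumℚ (map f vs) ≤ sumℚ (map g vs)
  sumℚ-map-mono f≤g []       = ≤-refl
  sumℚ-map-mono f≤g (v ∷ vs) = +-mono-≤ (f≤g v) (sumℚ-map-mono f≤g vs)

  sumℚ-map-+ : ∀ {f g h : A → ℚ} → (∀ v → h v ≡ f v + g v) →
               ∀ vs → sumℚ (map h vs) ≡ sumℚ (map f vs) + sumℚ (map g vs)
  sumℚ-map-+ h≗f+g []       = refl
  sumℚ-map-+ {f} {g} h≗f+g (v ∷ vs) =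
    trans (cong₂ _+_ (h≗f+g v) (sumℚ-map-+ h≗f+g vs)) (+-interchange (f v) (g v) _ _)

  sumℚ-map-* : ∀ {f h : A → ℚ} a → (∀ v → h v ≡ a * f v) →
               ∀ vs → sumℚ (map h vs) ≡ a * sumℚ (map f vs)
  sumℚ-map-* a h≗af []       = sym (*-zeroʳ a)
  sumℚ-map-* {f} a h≗af (v ∷ vs) =
    trans (cong₂ _+_ (h≗af v) (sumℚ-map-* a h≗af vs)) (sym (*-distribˡ-+ a (f v) _))

sumℚ-++ : ∀ xs ys → sumℚ (xs ++ ys) ≡ sumℚ xs + sumℚ ys
sumℚ-++ []       ys = sym (+-identityˡ (sumℚ ys))
sumℚ-++ (x ∷ xs) ys = trans (cong (x +_) (sumℚ-++ xs ys)) (sym (+-assoc x (sumℚ xs) (sumℚ ys)))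

module _ {V : Set} where

  record ConvexCombination (w P Q R : V → ℚ) : Set where
    field
      a b c : ℚ
      0≤a   : 0ℚ ≤ a
      0≤b   : 0ℚ ≤ b
      0≤c   : 0ℚ ≤ c
      sum≡1 : a + b + c ≡ 1ℚ
      w≗    : ∀ v → w v ≡ a * P v + b * Q v + c * R v

  module _ {w P Q R : V → ℚ} (κ : ConvexCombination w P Q R) where
    open ConvexCombination κ

    rotate : ConvexCombination w Q R P
    rotate = record
      { 0≤a = 0≤b ; 0≤b = 0≤c ; 0≤c = 0≤a
      ; sum≡1 = trans (rotation a b c) sum≡1
      ; w≗ = λ v → trans (w≗ v) (sym (rotation (a * P v) (b * Q v) (c * R v)))
      }
      where
      rotation : ∀ x y z → y + z + x ≡ x + y + z
      rotation x y z = solve (x ∷ y ∷ z ∷ []) ℚ-ring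

    swap : ConvexCombination w P R Q
    swap = record
      { 0≤a = 0≤a ; 0≤b = 0≤c ; 0≤c = 0≤b
      ; sum≡1 = trans (transposition a b c) sum≡1
      ; w≗ = λ v → trans (w≗ v) (sym (transposition (a * P v) (b * Q v) (c * R v)))
      }
      where
      transposition : ∀ x y z → x + z + y ≡ x + y + z
      transposition x y z = solve (x ∷ y ∷ z ∷ []) ℚ-ring

    a≤1 : a ≤ 1ℚ
    a≤1 = ≤-trans (p≤p+q 0≤b) (≤-trans (p≤p+q 0≤c) (≤-reflexive sum≡1))

    concentrated : b ≡ 0ℚ → c ≡ 0ℚ → w ≗ P
    concentrated refl refl v = begin
      w v                                  ≡⟨ w≗ v ⟩
      a * P v + 0ℚ * Q v + 0ℚ * R v         ≡⟨ collect a (P v) (Q v) (R v) ⟩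
      (a + 0ℚ + 0ℚ) * P v                   ≡⟨ cong (_* P v) sum≡1 ⟩
      1ℚ * P v                             ≡⟨ *-identityˡ (P v) ⟩
      P v                                  ∎
      where
      open ≡-Reasoning
      collect : ∀ x p q r → x * p + 0ℚ * q + 0ℚ * r ≡ (x + 0ℚ + 0ℚ) * p
      collect x p q r = solve (x ∷ p ∷ q ∷ r ∷ []) ℚ-ring

module _ (𝒞 : FiniteClutter) where
  open FiniteClutter 𝒞

  sumOver-mono : ∀ C {x y} → (∀ v → x v ≤ y v) → sumOver 𝒞 C x ≤ sumOver 𝒞 C y
  sumOver-mono C {x} {y} x≤y = sumℚ-map-mono selected elems
    where
    selected : ∀ v → (if C v then x v else 0ℚ) ≤ (if C v then y v else 0ℚ)
    selected v with C v
    ... | true  = x≤y v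
    ... | false = ≤-refl

  sumOver-+ : ∀ C x y → sumOver 𝒞 C (λ v → x v + y v) ≡ sumOver 𝒞 C x + sumOver 𝒞 C y
  sumOver-+ C x y = sumℚ-map-+ selected elems
    where
    selected : ∀ v → (if C v then x v + y v else 0ℚ) ≡ (if C v then x v else 0ℚ) + (if C v then y v else 0ℚ)
    selected v with C v
    ... | true  = refl
    ... | false = refl

  sumOver-* : ∀ C a x → sumOver 𝒞 C (λ v → a * x v) ≡ a * sumOver 𝒞 C x
  sumOver-* C a x = sumℚ-map-* a selected elems
    where
    selected : ∀ v → (if C v then a * x v else 0ℚ) ≡ a * (if C v then x v else 0ℚ)
    selected v with C v
    ... | true  = refl
    ... | false = sym (*-zeroʳ a)

  InPolyhedron-mono : ∀ {x y} → InPolyhedron 𝒞 x → (∀ v → x v ≤ y v) → InPolyhedron 𝒞 y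
  InPolyhedron-mono (0≤x , x-covers) x≤y =
    (λ v → ≤-trans (0≤x v) (x≤y v)) , λ C C∈𝒞 → ≤-trans (x-covers C C∈𝒞) (sumOver-mono C x≤y)

  sumOver-combination : ∀ C a b c P Q R →
    sumOver 𝒞 C (λ v → a * P v + b * Q v + c * R v) ≡ a * sumOver 𝒞 C P + b * sumOver 𝒞 C Q + c * sumOver 𝒞 C R
  sumOver-combination C a b c P Q R =
    trans (sumOver-+ C _ _) (cong₂ _+_ (trans (sumOver-+ C _ _) (cong₂ _+_ (sumOver-* C a P) (sumOver-* C b Q)))
                                       (sumOver-* C c R))

  InPolyhedron-convex : ∀ {w P Q R} → InPolyhedron 𝒞 P → InPolyhedron 𝒞 Q → InPolyhedron 𝒞 R →
                        ConvexCombination w P Q R → InPolyhedron 𝒞 w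
  InPolyhedron-convex {w} {P} {Q} {R} (0≤P , P-covers) (0≤Q , Q-covers) (0≤R , R-covers) κ = 0≤w , w-covers
    where
    open ConvexCombination κ
    0≤w : ∀ v → 0ℚ ≤ w v
    0≤w v = subst (0ℚ ≤_) (sym (w≗ v))
                  (+-mono-≤ (+-mono-≤ (*-nonNeg 0≤a (0≤P v)) (*-nonNeg 0≤b (0≤Q v))) (*-nonNeg 0≤c (0≤R v)))
    w-covers : ∀ C → Member C → 1ℚ ≤ sumOver 𝒞 C w
    w-covers C C∈𝒞 = begin
      1ℚ                                                        ≡⟨ sym sum≡1 ⟩
      a + b + c                                                 ≡⟨ cong₂ _+_ (cong₂ _+_ (*-identityʳ a) (*-identityʳ b))
                                                                             (*-identityʳ c) ⟨
      a * 1ℚ + b * 1ℚ + c * 1ℚ                                  ≤⟨ +-mono-≤ (+-mono-≤ (*-monoˡ-≤-0≤ 0≤a (P-covers C C∈𝒞))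
                                                                                     (*-monoˡ-≤-0≤ 0≤b (Q-covers C C∈𝒞)))
                                                                           (*-monoˡ-≤-0≤ 0≤c (R-covers C C∈𝒞)) ⟩
      a * sumOver 𝒞 C P + b * sumOver 𝒞 C Q + c * sumOver 𝒞 C R ≡⟨ sumOver-combination C a b c P Q R ⟨
      sumOver 𝒞 C (λ v → a * P v + b * Q v + c * R v)           ≤⟨ sumOver-mono C (λ v → ≤-reflexive (sym (w≗ v))) ⟩
      sumOver 𝒞 C w                                             ∎
      where open ≤-Reasoning

  module _ {w : V → ℚ} (ext : IsExtremePoint 𝒞 w) where

    extreme-midpoint : ∀ {y z} → InPolyhedron 𝒞 y → InPolyhedron 𝒞 z →
                       (∀ v → w v ≡ ½ * y v + ½ * z v) → y ≗ z
    extreme-midpoint y∈P z∈P = proj₂ ext _ _ ½ y∈P z∈P (positive⁻¹ ½) ½<1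

    -- w is the midpoint of (1 + μ) w - μ X and (1 - μ) w + μ X, which differ by 2 μ (w - X).
    extreme-unextendable : ∀ {X μ} → InPolyhedron 𝒞 X → 0ℚ < μ → μ ≤ 1ℚ →
                           InPolyhedron 𝒞 (λ v → (1ℚ + μ) * w v + (- μ) * X v) → w ≗ X
    extreme-unextendable {X} {μ} X∈P 0<μ μ≤1 y∈P v =
      *-cancelˡ-pos (+-mono-< 0<μ 0<μ) (≡-by-difference (y≗z v) (doubled (w v) (X v)))
      where
      κ : ConvexCombination (λ v → (1ℚ - μ) * w v + μ * X v) w X X
      κ = record
        { 0≤a = 0≤q-p μ≤1 ; 0≤b = <⇒≤ 0<μ ; 0≤c = ≤-refl
        ; sum≡1 = solve (μ ∷ []) ℚ-ring
        ; w≗ = λ v → sym (trans (cong ((1ℚ - μ) * w v + μ * X v +_) (*-zeroˡ (X v))) (+-identityʳ _))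
        }
      halves : ∀ W X → W ≡ ½ * ((1ℚ + μ) * W + (- μ) * X) + ½ * ((1ℚ - μ) * W + μ * X)
      halves W X = solve (μ ∷ W ∷ X ∷ []) ℚ-ring
      doubled : ∀ W X → (μ + μ) * W ≡ (μ + μ) * X + (((1ℚ + μ) * W + (- μ) * X) - ((1ℚ - μ) * W + μ * X))
      doubled W X = solve (μ ∷ W ∷ X ∷ []) ℚ-ring
      y≗z : (λ v → (1ℚ + μ) * w v + (- μ) * X v) ≗ (λ v → (1ℚ - μ) * w v + μ * X v)
      y≗z = extreme-midpoint y∈P (InPolyhedron-convex (proj₁ ext) X∈P X∈P κ) (λ v → halves (w v) (X v))

    extreme-minimal : ∀ {u} → InPolyhedron 𝒞 u → (∀ v → u v ≤ w v) → w ≗ u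
    extreme-minimal {u} u∈P u≤w =
      extreme-unextendable u∈P (positive⁻¹ 1ℚ) ≤-refl (InPolyhedron-mono (proj₁ ext) w≤2w-u)
      where
      twice-minus : ∀ W U → W + (W - U) ≡ (1ℚ + 1ℚ) * W + (- 1ℚ) * U
      twice-minus W U = solve (W ∷ U ∷ []) ℚ-ring
      w≤2w-u : ∀ v → w v ≤ (1ℚ + 1ℚ) * w v + (- 1ℚ) * u v
      w≤2w-u v = ≤-trans (p≤p+q (0≤q-p (u≤w v))) (≤-reflexive (twice-minus (w v) (u v)))

    -- w is the midpoint of the combinations with weights (a ∓ a b, b ± a b, c), which differ by 2 a b (P - Q).
    positive-weights-agree : ∀ {P Q R} → InPolyhedron 𝒞 P → InPolyhedron 𝒞 Q → InPolyhedron 𝒞 R →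
                             (κ : ConvexCombination w P Q R) →
                             0ℚ < ConvexCombination.a κ → 0ℚ < ConvexCombination.b κ → P ≗ Q
    positive-weights-agree {P} {Q} {R} P∈P Q∈P R∈P κ 0<a 0<b v =
      *-cancelˡ-pos (+-mono-< (*-pos 0<a 0<b) (*-pos 0<a 0<b))
                    (≡-by-difference (sym (y≗z v)) (doubled a b c (P v) (Q v) (R v)))
      where
      open ConvexCombination κ
      factorˡ : ∀ x y → x - x * y ≡ x * (1ℚ - y)
      factorˡ x y = solve (x ∷ y ∷ []) ℚ-ring
      factorʳ : ∀ x y → y - x * y ≡ y * (1ℚ - x)
      factorʳ x y = solve (x ∷ y ∷ []) ℚ-ring
      0≤a-ab : 0ℚ ≤ a - a * b
      0≤a-ab = subst (0ℚ ≤_) (sym (factorˡ a b)) (*-nonNeg 0≤a (0≤q-p (a≤1 (rotate κ))))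
      0≤b-ab : 0ℚ ≤ b - a * b
      0≤b-ab = subst (0ℚ ≤_) (sym (factorʳ a b)) (*-nonNeg 0≤b (0≤q-p (a≤1 κ)))
      shifted : ∀ x y z → (x - x * y) + (y + x * y) + z ≡ x + y + z
      shifted x y z = solve (x ∷ y ∷ z ∷ []) ℚ-ring
      shifted′ : ∀ x y z → (x + x * y) + (y - x * y) + z ≡ x + y + z
      shifted′ x y z = solve (x ∷ y ∷ z ∷ []) ℚ-ring
      κʸ : ConvexCombination (λ v → (a - a * b) * P v + (b + a * b) * Q v + c * R v) P Q R
      κʸ = record { 0≤a = 0≤a-ab ; 0≤b = +-mono-≤ 0≤b (*-nonNeg 0≤a 0≤b) ; 0≤c = 0≤c
                  ; sum≡1 = trans (shifted a b c) sum≡1 ; w≗ = λ _ → refl }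
      κᶻ : ConvexCombination (λ v → (a + a * b) * P v + (b - a * b) * Q v + c * R v) P Q R
      κᶻ = record { 0≤a = +-mono-≤ 0≤a (*-nonNeg 0≤a 0≤b) ; 0≤b = 0≤b-ab ; 0≤c = 0≤c
                  ; sum≡1 = trans (shifted′ a b c) sum≡1 ; w≗ = λ _ → refl }
      halves : ∀ x y z p q r → x * p + y * q + z * r
             ≡ ½ * ((x - x * y) * p + (y + x * y) * q + z * r) + ½ * ((x + x * y) * p + (y - x * y) * q + z * r)
      halves x y z p q r = solve (x ∷ y ∷ z ∷ p ∷ q ∷ r ∷ []) ℚ-ring
      doubled : ∀ x y z p q r → (x * y + x * y) * p
              ≡ (x * y + x * y) * q + (((x + x * y) * p + (y - x * y) * q + z * r)
                                        - ((x - x * y) * p + (y + x * y) * q + z * r))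
      doubled x y z p q r = solve (x ∷ y ∷ z ∷ p ∷ q ∷ r ∷ []) ℚ-ring
      y≗z : (λ v → (a - a * b) * P v + (b + a * b) * Q v + c * R v)
          ≗ (λ v → (a + a * b) * P v + (b - a * b) * Q v + c * R v)
      y≗z = extreme-midpoint (InPolyhedron-convex P∈P Q∈P R∈P κʸ) (InPolyhedron-convex P∈P Q∈P R∈P κᶻ)
                             (λ v → trans (w≗ v) (halves a b c (P v) (Q v) (R v)))

    extreme-vertex : ∀ {P Q R} → InPolyhedron 𝒞 P → InPolyhedron 𝒞 Q → InPolyhedron 𝒞 R →
                     ConvexCombination w P Q R → ¬ P ≗ Q → ¬ P ≗ R → ¬ Q ≗ R → w ≗ P ⊎ w ≗ Q ⊎ w ≗ R
    extreme-vertex {P} {Q} {R} P∈P Q∈P R∈P κ P≉Q P≉R Q≉R = by-signs (0ℚ <? a) (0ℚ <? b) (0ℚ <? c)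
      where
      open ConvexCombination κ
      by-signs : Dec (0ℚ < a) → Dec (0ℚ < b) → Dec (0ℚ < c) → w ≗ P ⊎ w ≗ Q ⊎ w ≗ R
      by-signs (yes 0<a) (yes 0<b) _         = ⊥-elim (P≉Q (positive-weights-agree P∈P Q∈P R∈P κ 0<a 0<b))
      by-signs (yes 0<a) (no _)    (yes 0<c) = ⊥-elim (P≉R (positive-weights-agree P∈P R∈P Q∈P (swap κ) 0<a 0<c))
      by-signs (no _)    (yes 0<b) (yes 0<c) = ⊥-elim (Q≉R (positive-weights-agree Q∈P R∈P P∈P (rotate κ) 0<b 0<c))
      by-signs _         (no b≯0)  (no c≯0)  =
        inj₁ (concentrated κ (nonNeg∧≯0⇒≡0 0≤b b≯0) (nonNeg∧≯0⇒≡0 0≤c c≯0))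
      by-signs (no a≯0)  (yes _)   (no c≯0)  =
        inj₂ (inj₁ (concentrated (rotate κ) (nonNeg∧≯0⇒≡0 0≤c c≯0) (nonNeg∧≯0⇒≡0 0≤a a≯0)))
      by-signs (no a≯0)  (no b≯0)  (yes _)   =
        inj₂ (inj₂ (concentrated (rotate (rotate κ)) (nonNeg∧≯0⇒≡0 0≤a a≯0) (nonNeg∧≯0⇒≡0 0≤b b≯0)))

    -- For μ = min m 1, the point (1 + μ) w - μ 𝟙_D is nonnegative, as w ≥ μ on D, and covers every member.
    extreme-exact-transversal : ∀ (D : V → Bool) {m} →
                                (∀ C → Member C → sumOver 𝒞 C (λ v → 𝟙 (D v)) ≡ 1ℚ) →
                                0ℚ < m → (∀ v → D v ≡ true → m ≤ w v) → w ≗ (λ v → 𝟙 (D v))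
    extreme-exact-transversal D {m} D-exact 0<m m≤w =
      extreme-unextendable D∈P 0<μ (p⊓q≤q m 1ℚ) (0≤y , y-covers)
      where
      μ : ℚ
      μ = m ⊓ 1ℚ
      0<μ : 0ℚ < μ
      0<μ with ⊓-sel m 1ℚ
      ... | inj₁ μ≡m = subst (0ℚ <_) (sym μ≡m) 0<m
      ... | inj₂ μ≡1 = subst (0ℚ <_) (sym μ≡1) (positive⁻¹ 1ℚ)
      0≤1+μ : 0ℚ ≤ 1ℚ + μ
      0≤1+μ = +-mono-≤ 0≤1 (<⇒≤ 0<μ)
      D∈P : InPolyhedron 𝒞 (λ v → 𝟙 (D v))
      D∈P = (λ v → 0≤𝟙 (D v)) , λ C C∈𝒞 → ≤-reflexive (sym (D-exact C C∈𝒞))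
      0≤y : ∀ v → 0ℚ ≤ (1ℚ + μ) * w v + (- μ) * 𝟙 (D v)
      0≤y v with D v in Dv
      ... | true  = subst (0ℚ ≤_) (sym (square-gap μ (w v)))
                      (+-mono-≤ (*-nonNeg (<⇒≤ 0<μ) (<⇒≤ 0<μ))
                                (*-nonNeg 0≤1+μ (0≤q-p (≤-trans (p⊓q≤p m 1ℚ) (m≤w v Dv)))))
        where
        square-gap : ∀ x W → (1ℚ + x) * W + (- x) * 1ℚ ≡ x * x + (1ℚ + x) * (W - x)
        square-gap x W = solve (x ∷ W ∷ []) ℚ-ring
      ... | false = subst (0ℚ ≤_) (sym (trans (cong ((1ℚ + μ) * w v +_) (*-zeroʳ (- μ))) (+-identityʳ _)))
                      (*-nonNeg 0≤1+μ (proj₁ (proj₁ ext) v))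
      y-covers : ∀ C → Member C → 1ℚ ≤ sumOver 𝒞 C (λ v → (1ℚ + μ) * w v + (- μ) * 𝟙 (D v))
      y-covers C C∈𝒞 = begin
        1ℚ                                        ≤⟨ p≤p+q (*-nonNeg 0≤1+μ (0≤q-p (proj₂ (proj₁ ext) C C∈𝒞))) ⟩
        1ℚ + (1ℚ + μ) * (sumOver 𝒞 C w - 1ℚ)      ≡⟨ excess μ (sumOver 𝒞 C w) ⟩
        (1ℚ + μ) * sumOver 𝒞 C w + (- μ) * 1ℚ     ≡⟨ cong (λ t → (1ℚ + μ) * sumOver 𝒞 C w + (- μ) * t) (D-exact C C∈𝒞) ⟨
        (1ℚ + μ) * sumOver 𝒞 C w + (- μ) * sumOver 𝒞 C (λ v → 𝟙 (D v))
                                                  ≡⟨ cong₂ _+_ (sumOver-* C (1ℚ + μ) w) (sumOver-* C (- μ) _) ⟨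
        sumOver 𝒞 C (λ v → (1ℚ + μ) * w v) + sumOver 𝒞 C (λ v → (- μ) * 𝟙 (D v))
                                                  ≡⟨ sumOver-+ C _ _ ⟨
        sumOver 𝒞 C (λ v → (1ℚ + μ) * w v + (- μ) * 𝟙 (D v)) ∎
        where
        open ≤-Reasoning
        excess : ∀ x S → 1ℚ + (1ℚ + x) * (S - 1ℚ) ≡ (1ℚ + x) * S + (- x) * 1ℚ
        excess x S = solve (x ∷ S ∷ []) ℚ-ring

module FinSum {c ℓ} (M : CommutativeMonoid c ℓ) where
  open CommutativeMonoid M using (Carrier; _≈_; setoid; ∙-congˡ; identityʳ) renaming (_∙_ to _+ᴹ_; ε to 0ᴹ)
  open import Algebra.Properties.CommutativeMonoid.Sum M public
  open import Data.Vec.Functional using (removeAt)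
  open import Relation.Binary.Reasoning.Setoid setoid

  sum-zero : ∀ {n} {f : Fin n → Carrier} → (∀ k → f k ≈ 0ᴹ) → sum f ≈ 0ᴹ
  sum-zero {n} {f} f≈0 = begin
    sum f                ≈⟨ sum-cong-≋ f≈0 ⟩
    sum {n} (λ _ → 0ᴹ)   ≈⟨ sum-replicate-zero n ⟩
    0ᴹ                   ∎

  sum-single : ∀ {n} (f : Fin n → Carrier) j → (∀ k → k ≢ j → f k ≈ 0ᴹ) → sum f ≈ f j
  sum-single {suc n} f j f≈0 = begin
    sum f                          ≈⟨ sum-remove f ⟩
    f j +ᴹ sum (removeAt f j)      ≈⟨ ∙-congˡ (sum-zero (λ k → f≈0 (punchIn j k) (punchInᵢ≢i j k))) ⟩
    f j +ᴹ 0ᴹ                      ≈⟨ identityʳ (f j) ⟩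
    f j                            ∎

  sum-pair : ∀ {n} (f : Fin n → Carrier) {j j′} (j≢j′ : j ≢ j′) →
             (∀ k → k ≢ j → k ≢ j′ → f k ≈ 0ᴹ) → sum f ≈ f j +ᴹ f j′
  sum-pair {suc n} f {j} {j′} j≢j′ f≈0 = begin
    sum f                                      ≈⟨ sum-remove f ⟩
    f j +ᴹ sum (removeAt f j)                  ≈⟨ ∙-congˡ (sum-single (removeAt f j) (punchOut j≢j′) others) ⟩
    f j +ᴹ f (punchIn j (punchOut j≢j′))       ≡⟨ cong (λ k → f j +ᴹ f k) (punchIn-punchOut j≢j′) ⟩
    f j +ᴹ f j′                                ∎
    where
    others : ∀ k → k ≢ punchOut j≢j′ → f (punchIn j k) ≈ 0ᴹ
    others k k≢ = f≈0 (punchIn j k) (punchInᵢ≢i j k)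
                      (λ eq → k≢ (punchIn-injective j k _ (trans eq (sym (punchIn-punchOut j≢j′)))))

module ℚ∑ = FinSum +-0-commutativeMonoid

sum-mono-≤ : ∀ {n} {f g : Fin n → ℚ} → (∀ k → f k ≤ g k) → ℚ∑.sum f ≤ ℚ∑.sum g
sum-mono-≤ {ℕ.zero} f≤g = ≤-refl
sum-mono-≤ {suc n}  f≤g = +-mono-≤ (f≤g Fin.zero) (sum-mono-≤ (λ k → f≤g (Fin.suc k)))

sum-nonNeg : ∀ {n} {f : Fin n → ℚ} → (∀ k → 0ℚ ≤ f k) → 0ℚ ≤ ℚ∑.sum f
sum-nonNeg {n} {f} 0≤f = subst (_≤ ℚ∑.sum f) (ℚ∑.sum-zero {n} {λ _ → 0ℚ} (λ _ → refl)) (sum-mono-≤ 0≤f)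

term≤sum : ∀ {n} {f : Fin n → ℚ} → (∀ k → 0ℚ ≤ f k) → ∀ j → f j ≤ ℚ∑.sum f
term≤sum {suc n} {f} 0≤f j =
  ≤-trans (p≤p+q (sum-nonNeg (λ k → 0≤f (punchIn j k)))) (≤-reflexive (sym (ℚ∑.sum-remove {i = j} f)))

sumℚ-tabulate : ∀ {A : Set} {n} (f : Fin n → A) (g : A → ℚ) → sumℚ (map g (tabulate f)) ≡ ℚ∑.sum (λ k → g (f k))
sumℚ-tabulate {n = ℕ.zero} f g = refl
sumℚ-tabulate {n = suc n}  f g = cong (g (f Fin.zero) +_) (sumℚ-tabulate (λ k → f (Fin.suc k)) g)

⊕-identityʳ : ∀ a → a ⊕ o ≡ a
⊕-identityʳ o  = refl
⊕-identityʳ i  = refl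
⊕-identityʳ ω  = refl
⊕-identityʳ ω² = refl

⊕-self : ∀ a → a ⊕ a ≡ o
⊕-self o  = refl
⊕-self i  = refl
⊕-self ω  = refl
⊕-self ω² = refl

⊕-comm : ∀ a b → a ⊕ b ≡ b ⊕ a
⊕-comm o  b  = sym (⊕-identityʳ b)
⊕-comm a  o  = ⊕-identityʳ a
⊕-comm i  i  = refl
⊕-comm i  ω  = refl
⊕-comm i  ω² = refl
⊕-comm ω  i  = refl
⊕-comm ω  ω  = refl
⊕-comm ω  ω² = refl
⊕-comm ω² i  = refl
⊕-comm ω² ω  = refl
⊕-comm ω² ω² = refl

⊕-assoc : ∀ a b c → (a ⊕ b) ⊕ c ≡ a ⊕ (b ⊕ c)
⊕-assoc o  b  c  = refl
⊕-assoc a  o  c  = cong (_⊕ c) (⊕-identityʳ a)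
⊕-assoc a  b  o  = trans (⊕-identityʳ (a ⊕ b)) (cong (a ⊕_) (sym (⊕-identityʳ b)))
⊕-assoc i  i  i  = refl
⊕-assoc i  i  ω  = refl
⊕-assoc i  i  ω² = refl
⊕-assoc i  ω  i  = refl
⊕-assoc i  ω  ω  = refl
⊕-assoc i  ω  ω² = refl
⊕-assoc i  ω² i  = refl
⊕-assoc i  ω² ω  = refl
⊕-assoc i  ω² ω² = refl
⊕-assoc ω  i  i  = refl
⊕-assoc ω  i  ω  = refl
⊕-assoc ω  i  ω² = refl
⊕-assoc ω  ω  i  = refl
⊕-assoc ω  ω  ω  = refl
⊕-assoc ω  ω  ω² = refl
⊕-assoc ω  ω² i  = refl
⊕-assoc ω  ω² ω  = refl
⊕-assoc ω  ω² ω² = refl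
⊕-assoc ω² i  i  = refl
⊕-assoc ω² i  ω  = refl
⊕-assoc ω² i  ω² = refl
⊕-assoc ω² ω  i  = refl
⊕-assoc ω² ω  ω  = refl
⊕-assoc ω² ω  ω² = refl
⊕-assoc ω² ω² i  = refl
⊕-assoc ω² ω² ω  = refl
⊕-assoc ω² ω² ω² = refl

⊕-cancelʳ : ∀ a b → (a ⊕ b) ⊕ b ≡ a
⊕-cancelʳ a b = trans (⊕-assoc a b b) (trans (cong (a ⊕_) (⊕-self b)) (⊕-identityʳ a))

⊕-commutativeMonoid : CommutativeMonoid 0ℓ 0ℓ
⊕-commutativeMonoid = record
  { Carrier = GF4 ; _≈_ = _≡_ ; _∙_ = _⊕_ ; ε = o
  ; isCommutativeMonoid = record
    { isMonoid = record
      { isSemigroup = record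
        { isMagma = record { isEquivalence = isEquivalence ; ∙-cong = cong₂ _⊕_ }
        ; assoc = ⊕-assoc }
      ; identity = (λ _ → refl) , ⊕-identityʳ }
    ; comm = ⊕-comm }
  }

module GF4∑ = FinSum ⊕-commutativeMonoid

sumGF4≡sum : ∀ n (s : Fin n → GF4) → sumGF4 n s ≡ GF4∑.sum s
sumGF4≡sum ℕ.zero  s = refl
sumGF4≡sum (suc n) s = cong (s Fin.zero ⊕_) (sumGF4≡sum n (λ k → s (Fin.suc k)))

_∈⟨_⟩ : GF4 → GF4 → Set
a ∈⟨ g ⟩ = a ≡ o ⊎ a ≡ g

⊕-∈⟨⟩ : ∀ {a b g} → a ∈⟨ g ⟩ → b ∈⟨ g ⟩ → (a ⊕ b) ∈⟨ g ⟩
⊕-∈⟨⟩ (inj₁ refl) b∈ = b∈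
⊕-∈⟨⟩ {g = g} (inj₂ refl) (inj₁ refl) = inj₂ (⊕-identityʳ g)
⊕-∈⟨⟩ {g = g} (inj₂ refl) (inj₂ refl) = inj₁ (⊕-self g)

sum-∈⟨⟩ : ∀ {n g} (s : Fin n → GF4) → (∀ k → s k ∈⟨ g ⟩) → GF4∑.sum s ∈⟨ g ⟩
sum-∈⟨⟩ {ℕ.zero} s s∈ = inj₁ refl
sum-∈⟨⟩ {suc n}  s s∈ = ⊕-∈⟨⟩ (s∈ Fin.zero) (sum-∈⟨⟩ (λ k → s (Fin.suc k)) (λ k → s∈ (Fin.suc k)))

∈-allGF4 : ∀ a → a ∈ allGF4
∈-allGF4 o  = here refl
∈-allGF4 i  = there (here refl)
∈-allGF4 ω  = there (there (here refl))
∈-allGF4 ω² = there (there (there (here refl)))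

halfˡ halfʳ : GF4 → GF4
halfˡ o  = o
halfˡ i  = ω
halfˡ ω  = i
halfˡ ω² = i
halfʳ o  = o
halfʳ i  = ω²
halfʳ ω  = ω²
halfʳ ω² = ω

halfˡ⊕halfʳ : ∀ h → halfˡ h ⊕ halfʳ h ≡ h
halfˡ⊕halfʳ o  = refl
halfˡ⊕halfʳ i  = refl
halfˡ⊕halfʳ ω  = refl
halfˡ⊕halfʳ ω² = refl

-- For h ≢ o the four elements o, h, halfˡ h, halfʳ h exhaust GF(4); part h s says which one s is.
data Part : Set where
  nil whole left right : Part

element : GF4 → Part → GF4
element h nil   = o
element h whole = h
element h left  = halfˡ h
element h right = halfʳ h

part : GF4 → GF4 → Part
part h s = if s ≟GF4 o then nil else if s ≟GF4 h then whole else if s ≟GF4 halfˡ h then left else right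

element-part : ∀ {h} → h ≢ o → ∀ s → element h (part h s) ≡ s
element-part {o}  h≢o _  = ⊥-elim (h≢o refl)
element-part {i}  _   o  = refl
element-part {i}  _   i  = refl
element-part {i}  _   ω  = refl
element-part {i}  _   ω² = refl
element-part {ω}  _   o  = refl
element-part {ω}  _   i  = refl
element-part {ω}  _   ω  = refl
element-part {ω}  _   ω² = refl
element-part {ω²} _   o  = refl
element-part {ω²} _   i  = refl
element-part {ω²} _   ω  = refl
element-part {ω²} _   ω² = refl

part-element : ∀ {h} → h ≢ o → ∀ c → part h (element h c) ≡ c
part-element {o}  h≢o _     = ⊥-elim (h≢o refl)
part-element {i}  _   nil   = refl
part-element {i}  _   whole = refl
part-element {i}  _   left  = refl
part-element {i}  _   right = refl
part-element {ω}  _   nil   = refl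
part-element {ω}  _   whole = refl
part-element {ω}  _   left  = refl
part-element {ω}  _   right = refl
part-element {ω²} _   nil   = refl
part-element {ω²} _   whole = refl
part-element {ω²} _   left  = refl
part-element {ω²} _   right = refl

element≡whole : ∀ {h} → h ≢ o → ∀ c → element h c ≡ h → c ≡ whole
element≡whole h≢o c e = trans (sym (part-element h≢o c)) (trans (cong (part _) e) (part-element h≢o whole))

-- The clutter mult(T)

module _ {n : ℕ} where

  sumOver-multIndicator : ∀ (t : Fin n → GF4) y → sumOver (multT n) (multIndicator n t) y ≡ ℚ∑.sum (λ k → y (k , t k))
  sumOver-multIndicator t y = trans (over-copies (allFin n)) (sumℚ-tabulate (λ k → k) (λ k → y (k , t k)))
    where
    selected : Fin n × GF4 → ℚ
    selected v = if multIndicator n t v then y v else 0ℚ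
    copy : ∀ k → sumℚ (map selected (map (k ,_) allGF4)) ≡ y (k , t k)
    copy k with t k
    ... | o  = +-identityʳ _
    ... | i  = trans (+-identityˡ _) (+-identityʳ _)
    ... | ω  = trans (+-identityˡ _) (trans (+-identityˡ _) (+-identityʳ _))
    ... | ω² = trans (+-identityˡ _) (trans (+-identityˡ _) (trans (+-identityˡ _) (+-identityʳ _)))
    over-copies : ∀ ks → sumℚ (map selected (cartesianProduct ks allGF4)) ≡ sumℚ (map (λ k → y (k , t k)) ks)
    over-copies []       = refl
    over-copies (k ∷ ks) = begin
      sumℚ (map selected (map (k ,_) allGF4 ++ cartesianProduct ks allGF4))
        ≡⟨ cong sumℚ (map-++ selected (map (k ,_) allGF4) (cartesianProduct ks allGF4)) ⟩
      sumℚ (map selected (map (k ,_) allGF4) ++ map selected (cartesianProduct ks allGF4))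
        ≡⟨ sumℚ-++ (map selected (map (k ,_) allGF4)) (map selected (cartesianProduct ks allGF4)) ⟩
      sumℚ (map selected (map (k ,_) allGF4)) + sumℚ (map selected (cartesianProduct ks allGF4))
        ≡⟨ cong₂ _+_ (copy k) (over-copies ks) ⟩
      y (k , t k) + sumℚ (map (λ k → y (k , t k)) ks) ∎
      where open ≡-Reasoning

  sumOver-member : ∀ {C} t → (∀ v → C v ≡ multIndicator n t v) → ∀ y →
                   sumOver (multT n) C y ≡ ℚ∑.sum (λ k → y (k , t k))
  sumOver-member {C} t C≗ y =
    trans (cong sumℚ (map-cong (λ v → cong (λ b → if b then y v else 0ℚ) (C≗ v)) (FiniteClutter.elems (multT n))))
          (sumOver-multIndicator t y)

  InPolyhedron-multT : ∀ {y} → InPolyhedron (multT n) y → ∀ t → InT n t → 1ℚ ≤ ℚ∑.sum (λ k → y (k , t k))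
  InPolyhedron-multT {y} (_ , y-covers) t t∈T =
    subst (1ℚ ≤_) (sumOver-multIndicator t y) (y-covers (multIndicator n t) (t , t∈T , λ _ → refl))

  multT-InPolyhedron : ∀ {y} → (∀ v → 0ℚ ≤ y v) → (∀ t → InT n t → 1ℚ ≤ ℚ∑.sum (λ k → y (k , t k))) →
                       InPolyhedron (multT n) y
  multT-InPolyhedron {y} 0≤y y-covers =
    0≤y , λ { C (t , t∈T , C≗) → subst (1ℚ ≤_) (sym (sumOver-member t C≗ y)) (y-covers t t∈T) }

  transversal-InPolyhedron : ∀ (D : Fin n × GF4 → Bool) → (∀ t → InT n t → ∃ λ k → D (k , t k) ≡ true) →
                             InPolyhedron (multT n) (λ v → 𝟙 (D v))
  transversal-InPolyhedron D D-hits = multT-InPolyhedron (λ v → 0≤𝟙 (D v)) hit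
    where
    hit : ∀ t → InT n t → 1ℚ ≤ ℚ∑.sum (λ k → 𝟙 (D (k , t k)))
    hit t t∈T with D-hits t t∈T
    ... | k , Dk = ≤-trans (≤-reflexive (cong 𝟙 (sym Dk))) (term≤sum (λ k → 0≤𝟙 (D (k , t k))) k)

  inCopy : Fin n → Fin n × GF4 → Bool
  inCopy j (k , _) = does (k Fin.≟ j)

  inCopy-exact : ∀ j C → FiniteClutter.Member (multT n) C → sumOver (multT n) C (λ v → 𝟙 (inCopy j v)) ≡ 1ℚ
  inCopy-exact j C (t , _ , C≗) =
    trans (sumOver-member t C≗ _)
          (trans (ℚ∑.sum-single _ j (λ k k≢j → cong 𝟙 (dec-false (k Fin.≟ j) k≢j)))
                 (cong 𝟙 (dec-true (j Fin.≟ j) refl)))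

  extreme-positive-copy : ∀ {w} → IsExtremePoint (multT n) w → ∀ j {m} → 0ℚ < m → (∀ a → m ≤ w (j , a)) →
                          w ≗ (λ v → 𝟙 (inCopy j v))
  extreme-positive-copy {w} ext j {m} 0<m m≤w =
    extreme-exact-transversal (multT n) ext (inCopy j) (inCopy-exact j) 0<m bounded
    where
    bounded : ∀ v → inCopy j v ≡ true → m ≤ w v
    bounded (k , a) with k Fin.≟ j
    ... | yes refl = λ _ → m≤w a
    ... | no _     = λ ()

argmin-minimal : ∀ {A : Set} {xs : List A} → (∀ a → a ∈ xs) → ∀ (f : A → ℚ) a₀ a → f (argmin f a₀ xs) ≤ f a
argmin-minimal {xs = xs} complete f a₀ a = lookup (f[argmin]≤f[xs] a₀ xs) (complete a)

lightest : ∀ {n} → (Fin n × GF4 → ℚ) → Fin n → GF4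
lightest w k = argmin (λ a → w (k , a)) o allGF4

-- Extreme points with a zero in every copy

module ZeroInEveryCopy {m} {w : Fin (suc m) × GF4 → ℚ} (ext : IsExtremePoint (multT (suc m)) w)
                       (zeros : Fin (suc m) → GF4) (w-zeros : ∀ k → w (k , zeros k) ≡ 0ℚ) where

  n : ℕ
  n = suc m

  h : GF4
  h = GF4∑.sum zeros

  W : Fin n → Part → ℚ
  W k c = w (k , element h c ⊕ zeros k)

  -- The member used is t k = element h (cls k) ⊕ zeros k; its coordinates sum to h ⊕ h.
  W-covers : ∀ (cls : Fin n → Part) → GF4∑.sum (λ k → element h (cls k)) ≡ h → 1ℚ ≤ ℚ∑.sum (λ k → W k (cls k))
  W-covers cls Σ≡h = InPolyhedron-multT (proj₁ ext) (λ k → element h (cls k) ⊕ zeros k) (begin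
    sumGF4 n (λ k → element h (cls k) ⊕ zeros k)              ≡⟨ sumGF4≡sum n (λ k → element h (cls k) ⊕ zeros k) ⟩
    GF4∑.sum (λ k → element h (cls k) ⊕ zeros k)              ≡⟨ GF4∑.∑-distrib-+ (λ k → element h (cls k)) zeros ⟩
    GF4∑.sum (λ k → element h (cls k)) ⊕ h                    ≡⟨ cong (_⊕ h) Σ≡h ⟩
    h ⊕ h                                                     ≡⟨ ⊕-self h ⟩
    o                                                         ∎)
    where open ≡-Reasoning

  -- Otherwise zeros itself would be a member of weight 0.
  h≢o : h ≢ o
  h≢o h≡o = <⇒≱ (positive⁻¹ 1ℚ) (subst (1ℚ ≤_) (ℚ∑.sum-zero w-zeros)
                       (W-covers (λ _ → nil) (trans (GF4∑.sum-zero {n} (λ _ → refl)) (sym h≡o))))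

  W-whole : ∀ j → 1ℚ ≤ W j whole
  W-whole j = subst (1ℚ ≤_) ΣW≡ (W-covers cls Σ≡h)
    where
    cls : Fin n → Part
    cls = updateAt (λ _ → nil) j (λ _ → whole)
    cls-off : ∀ k → k ≢ j → cls k ≡ nil
    cls-off k k≢j = updateAt-minimal k j _ k≢j
    Σ≡h : GF4∑.sum (λ k → element h (cls k)) ≡ h
    Σ≡h = trans (GF4∑.sum-single _ j (λ k k≢j → cong (element h) (cls-off k k≢j)))
                (cong (element h) (updateAt-updates j _))
    ΣW≡ : ℚ∑.sum (λ k → W k (cls k)) ≡ W j whole
    ΣW≡ = trans (ℚ∑.sum-single _ j (λ k k≢j → trans (cong (W k) (cls-off k k≢j)) (w-zeros k)))
                (cong (W j) (updateAt-updates j _))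

  W-halves : ∀ {j j′} → j ≢ j′ → 1ℚ ≤ W j left + W j′ right
  W-halves {j} {j′} j≢j′ = subst (1ℚ ≤_) ΣW≡ (W-covers cls Σ≡h)
    where
    cls : Fin n → Part
    cls = updateAt (updateAt (λ _ → nil) j (λ _ → left)) j′ (λ _ → right)
    cls-j : cls j ≡ left
    cls-j = trans (updateAt-minimal j j′ _ j≢j′) (updateAt-updates j _)
    cls-j′ : cls j′ ≡ right
    cls-j′ = updateAt-updates j′ _
    cls-off : ∀ k → k ≢ j → k ≢ j′ → cls k ≡ nil
    cls-off k k≢j k≢j′ = trans (updateAt-minimal k j′ _ k≢j′) (updateAt-minimal k j _ k≢j)
    Σ≡h : GF4∑.sum (λ k → element h (cls k)) ≡ h
    Σ≡h = trans (GF4∑.sum-pair _ j≢j′ (λ k k≢j k≢j′ → cong (element h) (cls-off k k≢j k≢j′)))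
                (trans (cong₂ (λ c c′ → element h c ⊕ element h c′) cls-j cls-j′) (halfˡ⊕halfʳ h))
    ΣW≡ : ℚ∑.sum (λ k → W k (cls k)) ≡ W j left + W j′ right
    ΣW≡ = trans (ℚ∑.sum-pair _ j≢j′ (λ k k≢j k≢j′ → trans (cong (W k) (cls-off k k≢j k≢j′)) (w-zeros k)))
                (cong₂ (λ c c′ → W j c + W j′ c′) cls-j cls-j′)

  w≡W-part : ∀ k a → w (k , a) ≡ W k (part h (a ⊕ zeros k))
  w≡W-part k a = cong (λ b → w (k , b))
    (sym (trans (cong (_⊕ zeros k) (element-part h≢o (a ⊕ zeros k))) (⊕-cancelʳ a (zeros k))))

  cover : (Fin n → Part → Bool) → Fin n × GF4 → Bool
  cover sel (k , a) = sel k (part h (a ⊕ zeros k))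

  cover-at : ∀ sel k c → cover sel (k , element h c ⊕ zeros k) ≡ sel k c
  cover-at sel k c = cong (sel k) (trans (cong (part h) (⊕-cancelʳ (element h c) (zeros k))) (part-element h≢o c))

  cover-InPolyhedron : ∀ sel → (∀ (s : Fin n → GF4) → GF4∑.sum s ≡ h → ∃ λ k → sel k (part h (s k)) ≡ true) →
                       InPolyhedron (multT n) (λ v → 𝟙 (cover sel v))
  cover-InPolyhedron sel hits = transversal-InPolyhedron (cover sel) λ t t∈T → hits (λ k → t k ⊕ zeros k) (begin
    GF4∑.sum (λ k → t k ⊕ zeros k)     ≡⟨ GF4∑.∑-distrib-+ t zeros ⟩
    GF4∑.sum t ⊕ h                     ≡⟨ cong (_⊕ h) (trans (sym (sumGF4≡sum n t)) t∈T) ⟩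
    h                                  ∎)
    where open ≡-Reasoning

  separated : ∀ sel sel′ k c → sel k c ≡ true → sel′ k c ≡ false →
              ¬ (λ v → 𝟙 (cover sel v)) ≗ (λ v → 𝟙 (cover sel′ v))
  separated sel sel′ k c sel≡true sel′≡false sel≗sel′ = 1≢0 (begin
    1ℚ                                        ≡⟨ cong 𝟙 (trans (sym sel≡true) (sym (cover-at sel k c))) ⟩
    𝟙 (cover sel (k , element h c ⊕ zeros k))   ≡⟨ sel≗sel′ (k , element h c ⊕ zeros k) ⟩
    𝟙 (cover sel′ (k , element h c ⊕ zeros k))  ≡⟨ cong 𝟙 (trans (cover-at sel′ k c) sel′≡false) ⟩
    0ℚ                                        ∎)
    where open ≡-Reasoning

  -- If no coordinate of s is selected, all of s lies in the subgroup ⟨ g ⟩, hence so does its sum h.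
  avoiding-subgroup : ∀ {g} → ¬ h ∈⟨ g ⟩ → (sel : Part → Bool) → (∀ c → sel c ≢ true → element h c ∈⟨ g ⟩) →
                      ∀ (s : Fin n → GF4) → GF4∑.sum s ≡ h → ∃ λ k → sel (part h (s k)) ≡ true
  avoiding-subgroup {g} h∉⟨g⟩ sel unselected∈⟨g⟩ s Σs≡h with any? (λ k → sel (part h (s k)) Bool.≟ true)
  ... | yes selected = selected
  ... | no none      = ⊥-elim (h∉⟨g⟩ (subst (_∈⟨ g ⟩) Σs≡h (sum-∈⟨⟩ s s∈⟨g⟩)))
    where
    s∈⟨g⟩ : ∀ k → s k ∈⟨ g ⟩
    s∈⟨g⟩ k = subst (_∈⟨ g ⟩) (element-part h≢o (s k)) (unselected∈⟨g⟩ (part h (s k)) (λ e → none (k , e)))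

  h∉⟨half⟩ : ∀ c → c ≢ whole → ¬ h ∈⟨ element h c ⟩
  h∉⟨half⟩ c c≢whole (inj₁ h≡o)      = h≢o h≡o
  h∉⟨half⟩ c c≢whole (inj₂ h≡element) = c≢whole (element≡whole h≢o c (sym h≡element))

  inA inB : Part → Bool
  inA whole = true
  inA left  = true
  inA _     = false
  inB whole = true
  inB right = true
  inB _     = false

  inE : Bool → Part → Bool
  inE _     nil   = false
  inE _     whole = true
  inE onKK  left  = not onKK
  inE onKK  right = not onKK

  A B : Fin n × GF4 → ℚ
  A v = 𝟙 (cover (λ _ → inA) v)
  B v = 𝟙 (cover (λ _ → inB) v)

  E-selection : Fin n → Fin n → Part → Bool
  E-selection kk k = inE (does (k Fin.≟ kk))

  E : Fin n → Fin n × GF4 → ℚ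
  E kk v = 𝟙 (cover (E-selection kk) v)

  A∈P : InPolyhedron (multT n) A
  A∈P = cover-InPolyhedron (λ _ → inA) (avoiding-subgroup (h∉⟨half⟩ right (λ ())) inA outside)
    where
    outside : ∀ c → inA c ≢ true → element h c ∈⟨ halfʳ h ⟩
    outside nil   _  = inj₁ refl
    outside right _  = inj₂ refl
    outside whole c∉ = ⊥-elim (c∉ refl)
    outside left  c∉ = ⊥-elim (c∉ refl)

  B∈P : InPolyhedron (multT n) B
  B∈P = cover-InPolyhedron (λ _ → inB) (avoiding-subgroup (h∉⟨half⟩ left (λ ())) inB outside)
    where
    outside : ∀ c → inB c ≢ true → element h c ∈⟨ halfˡ h ⟩
    outside nil   _  = inj₁ refl
    outside left  _  = inj₂ refl
    outside whole c∉ = ⊥-elim (c∉ refl)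
    outside right c∉ = ⊥-elim (c∉ refl)

  -- If no coordinate were selected, s would vanish off kk, so s kk = h, which is selected.
  E∈P : ∀ kk → InPolyhedron (multT n) (E kk)
  E∈P kk = cover-InPolyhedron (E-selection kk) hits
    where
    hits : ∀ (s : Fin n → GF4) → GF4∑.sum s ≡ h → ∃ λ k → E-selection kk k (part h (s k)) ≡ true
    hits s Σs≡h with any? (λ k → E-selection kk k (part h (s k)) Bool.≟ true)
    ... | yes selected = selected
    ... | no none      = ⊥-elim (none (kk , selected-kk))
      where
      nil-off : ∀ c → inE false c ≢ true → c ≡ nil
      nil-off nil   _  = refl
      nil-off whole c∉ = ⊥-elim (c∉ refl)
      nil-off left  c∉ = ⊥-elim (c∉ refl)
      nil-off right c∉ = ⊥-elim (c∉ refl)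
      s-off : ∀ k → k ≢ kk → s k ≡ o
      s-off k k≢kk = trans (sym (element-part h≢o (s k))) (cong (element h) (nil-off (part h (s k)) unselected))
        where
        unselected : inE false (part h (s k)) ≢ true
        unselected e = none (k , trans (cong (λ b → inE b (part h (s k))) (dec-false (k Fin.≟ kk) k≢kk)) e)
      s-kk : s kk ≡ h
      s-kk = trans (sym (GF4∑.sum-single s kk s-off)) Σs≡h
      selected-kk : E-selection kk kk (part h (s kk)) ≡ true
      selected-kk = cong (E-selection kk kk) (trans (cong (part h) s-kk) (part-element h≢o whole))

  p q : Fin n → ℚ
  p k = W k left
  q k = W k right

  vertex-from-weights : ∀ kk {a b c} → 0ℚ ≤ a → 0ℚ ≤ b → 0ℚ ≤ c → a + b + c ≡ 1ℚ →
                 a ≤ p kk → b ≤ q kk → (∀ k → k ≢ kk → a + c ≤ p k) → (∀ k → k ≢ kk → b + c ≤ q k) →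
                 w ≗ A ⊎ w ≗ B ⊎ w ≗ E kk
  vertex-from-weights kk {a} {b} {c} 0≤a 0≤b 0≤c sum≡1 a≤p b≤q a+c≤p b+c≤q =
    extreme-vertex (multT n) ext A∈P B∈P (E∈P kk) κʷ
      (separated (λ _ → inA) (λ _ → inB) kk left refl refl)
      (separated (λ _ → inA) (E-selection kk) kk left refl (E-at-kk left))
      (separated (λ _ → inB) (E-selection kk) kk right refl (E-at-kk right))
    where
    E-at-kk : ∀ c → inE (does (kk Fin.≟ kk)) c ≡ inE true c
    E-at-kk c = cong (λ b → inE b c) (dec-true (kk Fin.≟ kk) refl)
    u : Fin n × GF4 → ℚ
    u v = a * A v + b * B v + c * E kk v
    κ : ConvexCombination u A B (E kk)
    κ = record { 0≤a = 0≤a ; 0≤b = 0≤b ; 0≤c = 0≤c ; sum≡1 = sum≡1 ; w≗ = λ _ → refl }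
    bound : ∀ k c′ → a * 𝟙 (inA c′) + b * 𝟙 (inB c′) + c * 𝟙 (inE (does (k Fin.≟ kk)) c′) ≤ W k c′
    bound k nil = begin
      a * 0ℚ + b * 0ℚ + c * 0ℚ   ≡⟨ solve (a ∷ b ∷ c ∷ []) ℚ-ring ⟩
      0ℚ                         ≤⟨ proj₁ (proj₁ ext) _ ⟩
      W k nil                    ∎
      where open ≤-Reasoning
    bound k whole = begin
      a * 1ℚ + b * 1ℚ + c * 1ℚ   ≡⟨ solve (a ∷ b ∷ c ∷ []) ℚ-ring ⟩
      a + b + c                  ≡⟨ sum≡1 ⟩
      1ℚ                         ≤⟨ W-whole k ⟩
      W k whole                  ∎
      where open ≤-Reasoning
    bound k left with k Fin.≟ kk
    ... | yes refl = begin
      a * 1ℚ + b * 0ℚ + c * 0ℚ   ≡⟨ solve (a ∷ b ∷ c ∷ []) ℚ-ring ⟩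
      a                          ≤⟨ a≤p ⟩
      p k                        ∎
      where open ≤-Reasoning
    ... | no k≢kk = begin
      a * 1ℚ + b * 0ℚ + c * 1ℚ   ≡⟨ solve (a ∷ b ∷ c ∷ []) ℚ-ring ⟩
      a + c                      ≤⟨ a+c≤p k k≢kk ⟩
      p k                        ∎
      where open ≤-Reasoning
    bound k right with k Fin.≟ kk
    ... | yes refl = begin
      a * 0ℚ + b * 1ℚ + c * 0ℚ   ≡⟨ solve (a ∷ b ∷ c ∷ []) ℚ-ring ⟩
      b                          ≤⟨ b≤q ⟩
      q k                        ∎
      where open ≤-Reasoning
    ... | no k≢kk = begin
      a * 0ℚ + b * 1ℚ + c * 1ℚ   ≡⟨ solve (a ∷ b ∷ c ∷ []) ℚ-ring ⟩
      b + c                      ≤⟨ b+c≤q k k≢kk ⟩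
      q k                        ∎
      where open ≤-Reasoning
    u≤w : ∀ v → u v ≤ w v
    u≤w (k , a′) = subst (u (k , a′) ≤_) (sym (w≡W-part k a′)) (bound k (part h (a′ ⊕ zeros k)))
    κʷ : ConvexCombination w A B (E kk)
    κʷ = record { 0≤a = 0≤a ; 0≤b = 0≤b ; 0≤c = 0≤c ; sum≡1 = sum≡1
                ; w≗ = extreme-minimal (multT n) ext (InPolyhedron-convex (multT n) A∈P B∈P (E∈P kk) κ) u≤w }

  i₀ j₀ : Fin n
  i₀ = argmin p Fin.zero (allFin n)
  j₀ = argmin q Fin.zero (allFin n)

  α β : ℚ
  α = p i₀
  β = q j₀

  α≤p : ∀ k → α ≤ p k
  α≤p = argmin-minimal ∈-allFin p Fin.zero

  β≤q : ∀ k → β ≤ q k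
  β≤q = argmin-minimal ∈-allFin q Fin.zero

  0≤W : ∀ k c → 0ℚ ≤ W k c
  0≤W k c = proj₁ (proj₁ ext) _

  vertex-large-α : 1ℚ ≤ α → w ≗ A ⊎ w ≗ B ⊎ w ≗ E i₀
  vertex-large-α 1≤α =
    vertex-from-weights i₀ 0≤1 ≤-refl ≤-refl refl 1≤α (0≤W i₀ right) (λ k _ → ≤-trans 1≤α (α≤p k)) (λ k _ → 0≤W k right)

  vertex-large-α+β : α < 1ℚ → 1ℚ ≤ α + β → w ≗ A ⊎ w ≗ B ⊎ w ≗ E i₀
  vertex-large-α+β α<1 1≤α+β =
    vertex-from-weights i₀ (0≤W i₀ left) (0≤q-p (<⇒≤ α<1)) ≤-refl (complement α) ≤-refl
      (≤-trans 1-α≤β (β≤q i₀)) (λ k _ → subst (_≤ p k) (sym (+-identityʳ α)) (α≤p k))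
      (λ k _ → subst (_≤ q k) (sym (+-identityʳ (1ℚ - α))) (≤-trans 1-α≤β (β≤q k)))
    where
    complement : ∀ x → x + (1ℚ - x) + 0ℚ ≡ 1ℚ
    complement x = solve (x ∷ []) ℚ-ring
    1-α≤β : 1ℚ - α ≤ β
    1-α≤β = p≤q+r⇒p-q≤r {q = α} 1≤α+β

  vertex-small-α+β : α + β < 1ℚ → i₀ ≡ j₀ → w ≗ A ⊎ w ≗ B ⊎ w ≗ E i₀
  vertex-small-α+β α+β<1 i₀≡j₀ =
    vertex-from-weights i₀ (0≤W i₀ left) (0≤W j₀ right) (0≤q-p (<⇒≤ α+β<1)) (complement α β) ≤-refl
      (≤-reflexive (cong q (sym i₀≡j₀)))
      (λ k k≢i₀ → begin
        α + (1ℚ - (α + β))   ≡⟨ drop-first α β ⟩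
        1ℚ - β               ≤⟨ p≤q+r⇒p-r≤q {r = β} (subst (λ j → 1ℚ ≤ p k + q j) i₀≡j₀ (W-halves k≢i₀)) ⟩
        p k                  ∎)
      (λ k k≢i₀ → begin
        β + (1ℚ - (α + β))   ≡⟨ drop-second α β ⟩
        1ℚ - α               ≤⟨ p≤q+r⇒p-q≤r {q = α} (W-halves (λ i₀≡k → k≢i₀ (sym i₀≡k))) ⟩
        q k                  ∎)
    where
    open ≤-Reasoning
    complement : ∀ x y → x + y + (1ℚ - (x + y)) ≡ 1ℚ
    complement x y = solve (x ∷ y ∷ []) ℚ-ring
    drop-first : ∀ x y → x + (1ℚ - (x + y)) ≡ 1ℚ - y
    drop-first x y = solve (x ∷ y ∷ []) ℚ-ring
    drop-second : ∀ x y → y + (1ℚ - (x + y)) ≡ 1ℚ - x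
    drop-second x y = solve (x ∷ y ∷ []) ℚ-ring

  vertex : w ≗ A ⊎ w ≗ B ⊎ w ≗ E i₀
  vertex = by-size (1ℚ ≤? α) (1ℚ ≤? α + β) (i₀ Fin.≟ j₀)
    where
    by-size : Dec (1ℚ ≤ α) → Dec (1ℚ ≤ α + β) → Dec (i₀ ≡ j₀) → w ≗ A ⊎ w ≗ B ⊎ w ≗ E i₀
    by-size (yes 1≤α) _           _           = vertex-large-α 1≤α
    by-size (no 1≰α)  (yes 1≤α+β) _           = vertex-large-α+β (≰⇒> 1≰α) 1≤α+β
    by-size (no _)    (no 1≰α+β)  (yes i₀≡j₀) = vertex-small-α+β (≰⇒> 1≰α+β) i₀≡j₀
    -- W-halves gives 1 ≤ p i₀ + q j₀ = α + β.
    by-size (no _)    (no 1≰α+β)  (no i₀≢j₀)  = ⊥-elim (1≰α+β (W-halves i₀≢j₀))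

  is-indicator : ∃ λ D → w ≗ (λ v → 𝟙 (D v))
  is-indicator = indicator vertex
    where
    indicator : w ≗ A ⊎ w ≗ B ⊎ w ≗ E i₀ → ∃ λ D → w ≗ (λ v → 𝟙 (D v))
    indicator (inj₁ w≗A)        = cover (λ _ → inA) , w≗A
    indicator (inj₂ (inj₁ w≗B)) = cover (λ _ → inB) , w≗B
    indicator (inj₂ (inj₂ w≗E)) = cover (E-selection i₀) , w≗E

extreme⇒indicator : ∀ {m w} → IsExtremePoint (multT (suc m)) w → ∃ λ D → w ≗ (λ v → 𝟙 (D v))
extreme⇒indicator {m} {w} ext = by-zeros (all? (λ k → w (k , lightest w k) ≟ 0ℚ))
  where
  by-zeros : Dec (∀ k → w (k , lightest w k) ≡ 0ℚ) → ∃ λ D → w ≗ (λ v → 𝟙 (D v))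
  by-zeros (yes zeros)  = ZeroInEveryCopy.is-indicator ext (lightest w) zeros
  by-zeros (no ¬zeros)  = positive-copy (¬∀⟶∃¬ (suc m) _ (λ k → w (k , lightest w k) ≟ 0ℚ) ¬zeros)
    where
    positive-copy : (∃ λ j → w (j , lightest w j) ≢ 0ℚ) → ∃ λ D → w ≗ (λ v → 𝟙 (D v))
    positive-copy (j , w≢0) = inCopy j , extreme-positive-copy ext j (nonNeg∧≢0⇒pos (proj₁ (proj₁ ext) _) w≢0)
                                                                 (argmin-minimal ∈-allGF4 (λ a → w (j , a)) o)

indicator⇒integral : ∀ 𝒞 {w} → (∃ λ (D : FiniteClutter.V 𝒞 → Bool) → w ≗ (λ v → 𝟙 (D v))) → IsIntegral 𝒞 w
indicator⇒integral 𝒞 (D , w≗𝟙D) v with D v | w≗𝟙D v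
... | true  | w≡1 = ℤ.+ 1 , w≡1
... | false | w≡0 = ℤ.+ 0 , w≡0

lemma7p1 : (n : ℕ) → 3 ℕ.≤ n → Ideal (multT n)
lemma7p1 (suc m) _ w ext = indicator⇒integral (multT (suc m)) (extreme⇒indicator ext)
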